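{- Let $W_1$ be the graph defined below, with distinguished vertices $u,v$. If $S$ is an assignment of sets $S(z)\subseteq\mathbb{Z}$ with $|S(z)|=4$ for all vertices $z$ of $W_1$, then $|incomp(W_1,u,v,S)|\le 1$.
   Context: $W_1$ is the planar graph on the $9$ vertices $u,v,w,x_1,x_2,x_3,y_1,y_2,y_3$ with edges: the triangles $x_1x_2x_3$ and $y_1y_2y_3$; $wx_1, wx_3, wy_1, wy_3$; $uw, ux_1, ux_2, uy_1, uy_2$; and $vw, vx_2, vx_3, vy_2, vy_3$. For a graph $G=(V,E)$, two distinct vertices $u,v$ of $G$ and an assignment $S$ of sets $S(z)\subseteq\mathbb{Z}$ to all $z\in V$, $incomp(G,u,v,S)$ denotes the set of pairs $(a,b)\in S(u)\times S(v)$ such that there is no proper vertex coloring $c:V\to\mathbb{Z}$ with $c(u)=a$, $c(v)=b$ and $c(z)\in S(z)$ for all $z\in V$. -}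

module Defs where

open import Data.Integer using (ℤ)
open import Data.List using (List; length)
open import Data.List.Membership.Propositional using (_∈_)
open import Data.List.Relation.Unary.Unique.Propositional using (Unique)
open import Data.Nat using (ℕ)
open import Data.Product using (Σ; _×_; ∃)
open import Relation.Binary.PropositionalEquality using (_≡_; _≢_)
open import Relation.Nullary using (¬_)

-- The edge relation may list each edge in one orientation only; properness
-- of a colouring is insensitive to orientation.

-- A finite set S(z) ⊆ ℤ is represented as a duplicate-free list.
-- Proper colouring c of (V , E) respecting list assignment S.
ProperListColouring : (V : Set) (E : V → V → Set) (S : V → List ℤ) (c : V → ℤ) → Set
ProperListColouring V E S c =
  (∀ x y → E x y → c x ≢ c y) × (∀ z → c z ∈ S z)

Incomp : (V : Set) (E : V → V → Set) (u v : V) (S : V → List ℤ) → ℤ → ℤ → Set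
Incomp V E u v S a b =
  a ∈ S u × b ∈ S v ×
  ¬ (Σ (V → ℤ) λ c → ProperListColouring V E S c × c u ≡ a × c v ≡ b)

data W₁V : Set where
  u v w x₁ x₂ x₃ y₁ y₂ y₃ : W₁V

data W₁E : W₁V → W₁V → Set where
  x₁x₂ : W₁E x₁ x₂
  x₂x₃ : W₁E x₂ x₃
  x₁x₃ : W₁E x₁ x₃
  y₁y₂ : W₁E y₁ y₂
  y₂y₃ : W₁E y₂ y₃
  y₁y₃ : W₁E y₁ y₃
  wx₁ : W₁E w x₁
  wx₃ : W₁E w x₃
  wy₁ : W₁E w y₁
  wy₃ : W₁E w y₃
  uw : W₁E u w
  ux₁ : W₁E u x₁
  ux₂ : W₁E u x₂
  uy₁ : W₁E u y₁
  uy₂ : W₁E u y₂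
  vw : W₁E v w
  vx₂ : W₁E v x₂
  vx₃ : W₁E v x₃
  vy₂ : W₁E v y₂
  vy₃ : W₁E v y₃

-- Fix colours a, b, α of u, v, w with α ∉ {a, b}. Each triangle then needs distinct
-- colours from lists that keep at least two entries once the outer neighbours' colours
-- are removed, and greedy colouring succeeds unless the triangle is rigidly blocked:
-- then a is the only element of S(x₂) outside S(x₃), b the only one outside S(x₁), and
-- α the only element of S(x₁) outside {a} ∪ S(x₂). If (a, b) is incompatible, one of
-- the triangles is blocked for each of the at least two admissible α; since the y-triangle
-- determines α, the x-triangle is blocked for some α, and this determines (a, b) from
-- S(x₁), S(x₂), S(x₃) alone.
module Submission where

open import Defs
open import Data.Integer as ℤ using (ℤ)
open import Data.List using (List; length; []; _∷_; filter)
open import Data.List.Properties using (filter-notAll)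
open import Data.List.Membership.Propositional using (_∈_; _∉_)
open import Data.List.Membership.Propositional.Properties using (∈-filter⁺)
open import Data.List.Relation.Unary.All as All using ()
open import Data.List.Relation.Unary.Any as Any using (here; there)
open import Data.List.Relation.Unary.AllPairs using (_∷_)
open import Data.List.Relation.Unary.Unique.Propositional using (Unique)
open import Data.Nat using (_≤_; _<_)
open import Data.Nat.Properties using (<-≤-trans; ≤-pred; ≤-reflexive)
open import Data.Product using (Σ; ∃; _×_; _,_; proj₁; proj₂)
open import Data.Product.Properties using (≡-dec)
open import Function using (_∘_)
open import Relation.Binary.Definitions using (DecidableEquality)
open import Relation.Binary.PropositionalEquality
  using (_≡_; _≢_; refl; sym; cong₂; ≢-sym)
open import Relation.Nullary using (¬_; yes; no; ¬?)
open import Relation.Nullary.Decidable using (decidable-stable)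

module ListTriangles {A : Set} (_≟_ : DecidableEquality A) where

  open import Data.List.Membership.DecPropositional _≟_ using (_∈?_)

  ∃∉-of-longer : ∀ {S} → Unique S → (f : List A) → length f < length S →
                 ∃ λ z → z ∈ S × z ∉ f
  ∃∉-of-longer {y ∷ ys} (y≢ys ∷ ys-unique) f |f|<|S| with y ∈? f
  ... | no y∉f = y , here refl , y∉f
  ... | yes y∈f
    with ∃∉-of-longer ys-unique (filter (¬? ∘ (_≟ y)) f)
           (<-≤-trans (filter-notAll _ f (Any.map (λ { refl z≢z → z≢z refl }) y∈f))
                      (≤-pred |f|<|S|))
  ... | z , z∈ys , z∉f′ = z , there z∈ys , λ z∈f → z∉f′ (∈-filter⁺ _ z∈f z≢y)
    where
    z≢y : z ≢ y
    z≢y = ≢-sym (All.lookup y≢ys z∈ys)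

  ∈∧∉⇒≢ : ∀ {S : List A} {x z} → z ∈ S → x ∉ S → z ≢ x
  ∈∧∉⇒≢ z∈S x∉S refl = x∉S z∈S

  Has4Distinct : List A → Set
  Has4Distinct S = Unique S × 4 ≤ length S

  Avail : List A → A → A → A → Set
  Avail S p q z = z ∈ S × z ≢ p × z ≢ q

  avail-swap : ∀ {S p q z} → Avail S p q z → Avail S q p z
  avail-swap (z∈S , z≢p , z≢q) = z∈S , z≢q , z≢p

  pick-avail : ∀ {S} → Has4Distinct S → ∀ p q r → ∃ λ z → Avail S p q z × z ≢ r
  pick-avail (S-unique , 4≤|S|) p q r with ∃∉-of-longer S-unique (p ∷ q ∷ r ∷ []) 4≤|S|
  ... | z , z∈S , z∉pqr =
    z , (z∈S , z∉pqr ∘ here , z∉pqr ∘ there ∘ here) , z∉pqr ∘ there ∘ there ∘ here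

  record DistinctReps (P Q R : A → Set) : Set where
    constructor reps
    field
      {c₁ c₂ c₃} : A
      P-c₁ : P c₁
      Q-c₂ : Q c₂
      R-c₃ : R c₃
      c₁≢c₂ : c₁ ≢ c₂
      c₂≢c₃ : c₂ ≢ c₃
      c₁≢c₃ : c₁ ≢ c₃

  reps-rotate : ∀ {P Q R} → DistinctReps P Q R → DistinctReps Q R P
  reps-rotate (reps p q r c₁≢c₂ c₂≢c₃ c₁≢c₃) = reps q r p c₂≢c₃ (≢-sym c₁≢c₃) (≢-sym c₁≢c₂)

  reps-reverse : ∀ {P Q R} → DistinctReps P Q R → DistinctReps R Q P
  reps-reverse (reps p q r c₁≢c₂ c₂≢c₃ c₁≢c₃) =
    reps r q p (≢-sym c₂≢c₃) (≢-sym c₁≢c₂) (≢-sym c₁≢c₃)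

  reps-map-middle : ∀ {P Q Q′ R} → (∀ {z} → Q z → Q′ z) → DistinctReps P Q R → DistinctReps P Q′ R
  reps-map-middle f (reps p q r c₁≢c₂ c₂≢c₃ c₁≢c₃) = reps p (f q) r c₁≢c₂ c₂≢c₃ c₁≢c₃

  -- Colour the first vertex x, then the third, then the second, which avoids x for free.
  reps-of-private : ∀ {P S₂ S₃ p₂ q₂ p₃ q₃ x} → Has4Distinct S₂ → Has4Distinct S₃ →
                    P x → ¬ Avail S₂ p₂ q₂ x →
                    DistinctReps P (Avail S₂ p₂ q₂) (Avail S₃ p₃ q₃)
  reps-of-private {x = x} h₂ h₃ P-x x∉A₂ with pick-avail h₃ _ _ x
  ... | z₃ , A₃-z₃ , z₃≢x with pick-avail h₂ _ _ z₃
  ... | z₂ , A₂-z₂ , z₂≢z₃ =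
    reps P-x A₂-z₂ A₃-z₃ (λ { refl → x∉A₂ A₂-z₂ }) z₂≢z₃ (≢-sym z₃≢x)

  -- On S₂ the middle vertex is only constrained by r, so it can be coloured last.
  reps-of-slack : ∀ {S₁ S₂ S₃ p₁ q₁ p₃ q₃ Q} r →
                  Has4Distinct S₁ → Has4Distinct S₂ → Has4Distinct S₃ →
                  (∀ {z} → z ∈ S₂ → z ≢ r → Q z) →
                  DistinctReps (Avail S₁ p₁ q₁) Q (Avail S₃ p₃ q₃)
  reps-of-slack r h₁ h₂ h₃ slack with pick-avail h₁ _ _ r
  ... | z₁ , A₁-z₁ , _ with pick-avail h₃ _ _ z₁
  ... | z₃ , A₃-z₃ , z₃≢z₁ with pick-avail h₂ r z₁ z₃
  ... | z₂ , (z₂∈S₂ , z₂≢r , z₂≢z₁) , z₂≢z₃ =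
    reps A₁-z₁ (slack z₂∈S₂ z₂≢r) A₃-z₃ (≢-sym z₂≢z₁) z₂≢z₃ (≢-sym z₃≢z₁)

  -- The triangle x₁x₂x₃ (or y₁y₂y₃) of W₁ once u, v, w are coloured a, b, α.
  TriangleColouring : List A → List A → List A → A → A → A → Set
  TriangleColouring S₁ S₂ S₃ a b α =
    DistinctReps (Avail S₁ a α) (Avail S₂ a b) (Avail S₃ b α)

  infix 4 _∖_≡⁅_⁆

  _∖_≡⁅_⁆ : List A → List A → A → Set
  S ∖ T ≡⁅ x ⁆ = x ∈ S × x ∉ T × (∀ {z} → z ∈ S → z ∉ T → z ≡ x)

  ∖≡⁅⁆-unique : ∀ {S T x y} → S ∖ T ≡⁅ x ⁆ → S ∖ T ≡⁅ y ⁆ → x ≡ y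
  ∖≡⁅⁆-unique (_ , _ , only-x) (y∈S , y∉T , _) = sym (only-x y∈S y∉T)

  module Blocked {S₁ S₂ S₃ : List A}
                 (h₁ : Has4Distinct S₁) (h₂ : Has4Distinct S₂) (h₃ : Has4Distinct S₃)
                 {a b α : A} (α≢a : α ≢ a) (α≢b : α ≢ b)
                 (blocked : ¬ TriangleColouring S₁ S₂ S₃ a b α) where

    a≢b : a ≢ b
    a≢b refl = blocked (reps-of-slack a h₁ h₂ h₃ λ z∈S₂ z≢a → z∈S₂ , z≢a , z≢a)

    a∈S₂ : a ∈ S₂
    a∈S₂ = decidable-stable (a ∈? S₂) λ a∉S₂ →
      blocked (reps-of-slack b h₁ h₂ h₃ λ z∈S₂ z≢b → z∈S₂ , ∈∧∉⇒≢ z∈S₂ a∉S₂ , z≢b)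

    b∈S₃ : b ∈ S₃
    b∈S₃ = decidable-stable (b ∈? S₃) λ b∉S₃ →
      blocked (reps-rotate (reps-rotate
        (reps-of-slack α h₂ h₃ h₁ λ z∈S₃ z≢α → z∈S₃ , ∈∧∉⇒≢ z∈S₃ b∉S₃ , z≢α)))

    α∈S₁ : α ∈ S₁
    α∈S₁ = decidable-stable (α ∈? S₁) λ α∉S₁ →
      blocked (reps-rotate
        (reps-of-slack a h₃ h₁ h₂ λ z∈S₁ z≢a → z∈S₁ , z≢a , ∈∧∉⇒≢ z∈S₁ α∉S₁))

    a∉S₃ : a ∉ S₃
    a∉S₃ a∈S₃ = blocked (reps-rotate
      (reps-of-private h₁ h₂ (a∈S₃ , a≢b , ≢-sym α≢a) λ (_ , a≢a , _) → a≢a refl))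

    α∉S₂ : α ∉ S₂
    α∉S₂ α∈S₂ = blocked (reps-rotate (reps-rotate
      (reps-of-private h₃ h₁ (α∈S₂ , α≢a , α≢b) λ (_ , _ , α≢α) → α≢α refl)))

    S₂∖S₃≡⁅a⁆ : S₂ ∖ S₃ ≡⁅ a ⁆
    S₂∖S₃≡⁅a⁆ = a∈S₂ , a∉S₃ , λ {z} z∈S₂ z∉S₃ → decidable-stable (z ≟ a) λ z≢a →
      blocked (reps-rotate (reps-rotate
        (reps-of-private h₃ h₁ (z∈S₂ , z≢a , ≢-sym (∈∧∉⇒≢ b∈S₃ z∉S₃))
          λ (z∈S₃ , _) → z∉S₃ z∈S₃)))

    S₁∖aS₂≡⁅α⁆ : S₁ ∖ (a ∷ S₂) ≡⁅ α ⁆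
    S₁∖aS₂≡⁅α⁆ = α∈S₁ , (λ { (here α≡a) → α≢a α≡a ; (there α∈S₂) → α∉S₂ α∈S₂ }) ,
      λ {z} z∈S₁ z∉aS₂ → decidable-stable (z ≟ α) λ z≢α →
        blocked (reps-of-private h₂ h₃ (z∈S₁ , z∉aS₂ ∘ here , z≢α)
          λ (z∈S₂ , _) → z∉aS₂ (there z∈S₂))

  blocked-reverse : ∀ {S₁ S₂ S₃ a b α} → ¬ TriangleColouring S₁ S₂ S₃ a b α →
                    ¬ TriangleColouring S₃ S₂ S₁ b a α
  blocked-reverse blocked = blocked ∘ reps-reverse ∘ reps-map-middle avail-swap

open ListTriangles ℤ._≟_

W₁-colouring-of-triangles :
  (S : W₁V → List ℤ) → ∀ {a b α} → a ∈ S u → b ∈ S v → α ∈ S w → α ≢ a → α ≢ b →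
  TriangleColouring (S x₁) (S x₂) (S x₃) a b α →
  TriangleColouring (S y₁) (S y₂) (S y₃) a b α →
  Σ (W₁V → ℤ) λ c → ProperListColouring W₁V W₁E S c × c u ≡ a × c v ≡ b
W₁-colouring-of-triangles S {a} {b} {α} a∈Su b∈Sv α∈Sw α≢a α≢b
  (reps {k₁} {k₂} {k₃} (k₁∈ , k₁≢a , k₁≢α) (k₂∈ , k₂≢a , k₂≢b) (k₃∈ , k₃≢b , k₃≢α)
        k₁≢k₂ k₂≢k₃ k₁≢k₃)
  (reps {l₁} {l₂} {l₃} (l₁∈ , l₁≢a , l₁≢α) (l₂∈ , l₂≢a , l₂≢b) (l₃∈ , l₃≢b , l₃≢α)
        l₁≢l₂ l₂≢l₃ l₁≢l₃)
  = c , (proper , in-lists) , refl , refl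
  where
  c : W₁V → ℤ
  c u = a
  c v = b
  c w = α
  c x₁ = k₁
  c x₂ = k₂
  c x₃ = k₃
  c y₁ = l₁
  c y₂ = l₂
  c y₃ = l₃

  proper : ∀ p q → W₁E p q → c p ≢ c q
  proper _ _ x₁x₂ = k₁≢k₂
  proper _ _ x₂x₃ = k₂≢k₃
  proper _ _ x₁x₃ = k₁≢k₃
  proper _ _ y₁y₂ = l₁≢l₂
  proper _ _ y₂y₃ = l₂≢l₃
  proper _ _ y₁y₃ = l₁≢l₃
  proper _ _ wx₁ = ≢-sym k₁≢α
  proper _ _ wx₃ = ≢-sym k₃≢α
  proper _ _ wy₁ = ≢-sym l₁≢α
  proper _ _ wy₃ = ≢-sym l₃≢α
  proper _ _ uw = ≢-sym α≢a
  proper _ _ ux₁ = ≢-sym k₁≢a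
  proper _ _ ux₂ = ≢-sym k₂≢a
  proper _ _ uy₁ = ≢-sym l₁≢a
  proper _ _ uy₂ = ≢-sym l₂≢a
  proper _ _ vw = ≢-sym α≢b
  proper _ _ vx₂ = ≢-sym k₂≢b
  proper _ _ vx₃ = ≢-sym k₃≢b
  proper _ _ vy₂ = ≢-sym l₂≢b
  proper _ _ vy₃ = ≢-sym l₃≢b

  in-lists : ∀ z → c z ∈ S z
  in-lists u = a∈Su
  in-lists v = b∈Sv
  in-lists w = α∈Sw
  in-lists x₁ = k₁∈
  in-lists x₂ = k₂∈
  in-lists x₃ = k₃∈
  in-lists y₁ = l₁∈
  in-lists y₂ = l₂∈
  in-lists y₃ = l₃∈

module IncompatiblePair (S : W₁V → List ℤ) (h : ∀ z → Has4Distinct (S z))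
                        {a b : ℤ} (incomp : Incomp W₁V W₁E u v S a b) where

  Blockedˣ Blockedʸ : ℤ → Set
  Blockedˣ α = ¬ TriangleColouring (S x₁) (S x₂) (S x₃) a b α
  Blockedʸ α = ¬ TriangleColouring (S y₁) (S y₂) (S y₃) a b α

  not-both-colourable : ∀ {α} → α ∈ S w → α ≢ a → α ≢ b →
    ¬ (TriangleColouring (S x₁) (S x₂) (S x₃) a b α ×
       TriangleColouring (S y₁) (S y₂) (S y₃) a b α)
  not-both-colourable α∈Sw α≢a α≢b (X , Y) =
    let (a∈Su , b∈Sv , uncolourable) = incomp
    in uncolourable (W₁-colouring-of-triangles S a∈Su b∈Sv α∈Sw α≢a α≢b X Y)

  -- Blocking the y-triangle pins α down as the element of S(y₁) ∖ (a ∷ S(y₂)),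
  -- so of two admissible colours for w one blocks the x-triangle.
  ¬¬x-blocked : ¬ ¬ ∃ λ α → α ≢ a × α ≢ b × Blockedˣ α
  ¬¬x-blocked x-never-blocked with pick-avail (h w) a b b
  ... | α₁ , (α₁∈Sw , α₁≢a , α₁≢b) , _ with pick-avail (h w) a b α₁
  ... | α₂ , (α₂∈Sw , α₂≢a , α₂≢b) , α₂≢α₁ =
    α₂≢α₁ (∖≡⁅⁆-unique (y-sole α₂∈Sw α₂≢a α₂≢b) (y-sole α₁∈Sw α₁≢a α₁≢b))
    where
    y-blocked : ∀ {α} → α ∈ S w → α ≢ a → α ≢ b → Blockedʸ α
    y-blocked α∈Sw α≢a α≢b Y =
      x-never-blocked (_ , α≢a , α≢b , λ X → not-both-colourable α∈Sw α≢a α≢b (X , Y))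

    y-sole : ∀ {α} → α ∈ S w → α ≢ a → α ≢ b → S y₁ ∖ (a ∷ S y₂) ≡⁅ α ⁆
    y-sole α∈Sw α≢a α≢b =
      Blocked.S₁∖aS₂≡⁅α⁆ (h y₁) (h y₂) (h y₃) α≢a α≢b (y-blocked α∈Sw α≢a α≢b)

  ¬¬determined : ¬ ¬ (S x₂ ∖ S x₃ ≡⁅ a ⁆ × S x₂ ∖ S x₁ ≡⁅ b ⁆)
  ¬¬determined not-determined = ¬¬x-blocked λ (α , α≢a , α≢b , blocked) →
    not-determined
      ( Blocked.S₂∖S₃≡⁅a⁆ (h x₁) (h x₂) (h x₃) α≢a α≢b blocked
      , Blocked.S₂∖S₃≡⁅a⁆ (h x₃) (h x₂) (h x₁) α≢b α≢a (blocked-reverse blocked))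

lemma4p7 : (S : W₁V → List ℤ) →
    (∀ z → Unique (S z) × length (S z) ≡ 4) →
    ∀ a b a′ b′ →
    Incomp W₁V W₁E u v S a b → Incomp W₁V W₁E u v S a′ b′ →
    (a , b) ≡ (a′ , b′)
lemma4p7 S four a b a′ b′ I J =
  decidable-stable (≡-dec ℤ._≟_ ℤ._≟_ (a , b) (a′ , b′)) λ ab≢a′b′ →
    IncompatiblePair.¬¬determined S h I λ (Sa , Sb) →
    IncompatiblePair.¬¬determined S h J λ (Sa′ , Sb′) →
    ab≢a′b′ (cong₂ _,_ (∖≡⁅⁆-unique Sa Sa′) (∖≡⁅⁆-unique Sb Sb′))
  where
  h : ∀ z → Has4Distinct (S z)
  h z = proj₁ (four z) , ≤-reflexive (sym (proj₂ (four z)))
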